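{- For every integer $n\ge 6$, there exists a minimal uncolorable $3$-uniform bi-hypergraph with exactly $n$ vertices, and moreover $\mathrm{low}(n,3)\le \frac{7n}{3}-4$.
   Context: A bi-hypergraph is a pair $\mathcal{H}=(\mathcal{V},\mathcal{E})$ with $\mathcal{V}$ a finite set and $\mathcal{E}$ a Sperner family of subsets of $\mathcal{V}$ (edges); it is $r$-uniform if all edges have size $r$; its order is $|\mathcal{V}|$ and its size is $|\mathcal{E}|$. A proper coloring is a map $f:\mathcal{V}\to\mathbb{N}$ with $1<|\{f(v):v\in e\}|<|e|$ for every edge $e$; $\mathcal{H}$ is colorable if such $f$ exists. A subhypergraph is $(\mathcal{V}',\mathcal{E}')$ with $\mathcal{V}'\subseteq\mathcal{V}$, $\mathcal{E}'\subseteq\mathcal{E}$. $\mathcal{H}$ is minimal uncolorable if it is uncolorable but every proper subhypergraph is colorable. For integers $n,r$, $\mathrm{low}(n,r)$ denotes the minimum number of edges of a minimal uncolorable $r$-uniform bi-hypergraph of order $n$ (and $\infty$ if none exists). -}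

module Defs where

open import Data.Nat using (ℕ; _<_; _≟_)
open import Data.Fin using (Fin)
open import Data.Fin.Subset using (Subset; _∈_; _∉_; _⊆_; ∣_∣)
open import Data.Fin.Subset.Properties using (_∈?_)
open import Data.List using (List; length; map; filter; deduplicate; allFin)
open import Data.List.Relation.Unary.All using (All)
open import Data.List.Relation.Unary.Unique.Propositional using (Unique)
import Data.List.Membership.Propositional as LM
open import Data.Product using (Σ; ∃; _×_)
open import Data.Sum using (_⊎_)
open import Relation.Nullary using (¬_)
open import Relation.Binary.PropositionalEquality using (_≡_)

record BiHypergraph (n : ℕ) : Set where
  field
    edges   : List (Subset n)
    unique  : Unique edges
    sperner : ∀ {e e'} → e LM.∈ edges → e' LM.∈ edges → e ⊆ e' → e ≡ e'

open BiHypergraph public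

size : ∀ {n} → BiHypergraph n → ℕ
size H = length (edges H)

Uniform : ∀ {n} → ℕ → BiHypergraph n → Set
Uniform r H = All (λ e → ∣ e ∣ ≡ r) (edges H)

elems : ∀ {n} → Subset n → List (Fin n)
elems e = filter (_∈? e) (allFin _)

numColors : ∀ {n} → (Fin n → ℕ) → Subset n → ℕ
numColors f e = length (deduplicate _≟_ (map f (elems e)))

ProperColoring : ∀ {n} → (Fin n → ℕ) → List (Subset n) → Set
ProperColoring f E = All (λ e → 1 < numColors f e × numColors f e < ∣ e ∣) E

ColorableEdges : ∀ {n} → List (Subset n) → Set
ColorableEdges {n} E = Σ (Fin n → ℕ) λ f → ProperColoring f E

Colorable : ∀ {n} → BiHypergraph n → Set
Colorable H = ColorableEdges (edges H)

record Subhypergraph {n : ℕ} (H : BiHypergraph n) : Set where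
  field
    verts'   : Subset n
    edges'   : List (Subset n)
    edges'⊆E : All (LM._∈ edges H) edges'
    edges'⊆V : All (_⊆ verts') edges'

-- proper: differs from H, i.e. misses a vertex or misses an edge
ProperSub : ∀ {n} {H : BiHypergraph n} → Subhypergraph H → Set
ProperSub {n} {H} S =
  (∃ λ (v : Fin n) → v ∉ Subhypergraph.verts' S)
  ⊎ (∃ λ e → e LM.∈ edges H × ¬ (e LM.∈ Subhypergraph.edges' S))

-- colorability of a subhypergraph (a coloring of V' extended arbitrarily to Fin n)
SubColorable : ∀ {n} {H : BiHypergraph n} → Subhypergraph H → Set
SubColorable S = ColorableEdges (Subhypergraph.edges' S)

MinimalUncolorable : ∀ {n} → BiHypergraph n → Set
MinimalUncolorable H =
  ¬ Colorable H × (∀ (S : Subhypergraph H) → ProperSub S → SubColorable S)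

-- Bases: explicit minimal uncolourable 3-uniform bi-hypergraphs on 6, 7 and 8
-- vertices with 10, 12 and 14 edges.  Step: replace an edge abc by the gadget
-- on a, b, c and three new vertices x, y, z with edges xyz, xab, yab, zab, xyc,
-- xzc.  Every proper colouring of the gadget colours abc properly; conversely a
-- colouring of a, b, c extends to the whole gadget if abc is properly coloured,
-- and to the gadget minus any chosen edge otherwise.  Hence minimal
-- uncolourability survives the replacement, which adds 3 vertices and 5 edges
-- and so preserves 3|E| + 12 ≤ 7n.  Whether a colouring is proper depends only on
-- its kernel (which vertices share a colour), so every finite fact used (base
-- cases and gadget) is decided by checking one colouring per set partition.
module Submission where

open import Defs
import Data.Bool as Bool
open import Data.Empty using (⊥-elim)
open import Data.Fin using (Fin; zero; suc; #_; toℕ; splitAt; _↑ˡ_; _↑ʳ_)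
import Data.Fin.Properties as Fin
open import Data.Fin.Subset as Subset using (Subset; ∣_∣; ⊥; ⊤; ⁅_⁆; _∪_; _⊆_; inside; outside)
open import Data.Fin.Subset.Properties using (_∈?_; drop-there; drop-∷-⊆; ∉⊥; ∣⊥∣≡0; p⊆q⇒∣p∣≤∣q∣)
open import Data.List
  using (List; []; _∷_; _++_; map; filter; length; deduplicate; concatMap; allFin; drop)
open import Data.List.Properties
  using (filter-≐; filter-accept; filter-reject; length-map; map-tabulate; map-∘; map-id)
open import Data.List.Membership.Propositional using (_∈_; find; lose)
open import Data.List.Membership.Propositional.Properties
  using (∈-map⁺; ∈-map⁻; ∈-concatMap⁺; ∈-deduplicate⁺; ∈-++⁺ˡ; ∈-++⁺ʳ)
open import Data.List.Relation.Unary.All as All using (All; []; _∷_; all?)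
import Data.List.Relation.Unary.All.Properties as All
open import Data.List.Relation.Unary.AllPairs as AllPairs using ()
open import Data.List.Relation.Unary.Any as Any using (Any; here; there; any?)
import Data.List.Relation.Unary.Any.Properties as Any
open import Data.List.Relation.Unary.Unique.Propositional using (Unique)
import Data.List.Relation.Unary.Unique.Propositional.Properties as Unique
open import Data.Nat using (ℕ; zero; suc; _+_; _*_; _∸_; _<_; _≤_; _⊔_; _≟_; _<?_; _≤?_; s≤s)
open import Data.Nat.Properties
  using ( <⇒≢; m<n⇒m<1+n; n<1+n; +-cancelˡ-≡; <-≤-trans; m≤m+n; m≤m⊔n; m≤n⊔m; suc-injective
        ; *-distribˡ-+; +-assoc; +-mono-≤; ≤-refl; n≤1+n; m≤n⇒∃[o]m+o≡n; m+n≤o⇒m≤o∸n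
        ; module ≤-Reasoning)
open import Data.Product using (Σ; ∃; _×_; _,_; proj₁; proj₂)
open import Data.Sum using (inj₁; inj₂; [_,_])
open import Data.Vec as Vec using (Vec; []; _∷_; lookup; toList) renaming (_++_ to _⧺_)
open import Data.Vec.Membership.Propositional.Properties using (∈-lookup; ∈-toList⁺)
open import Data.Vec.Properties using (≡-dec; ++-injectiveˡ; ++-injectiveʳ)
import Data.Vec.Functional as Vector
open import Function using (_∘_; id; _⇔_; mk⇔; Equivalence)
open import Relation.Binary.Definitions using (DecidableEquality)
import Relation.Binary.Definitions as Binary
open import Relation.Binary.PropositionalEquality
  using (_≡_; _≢_; refl; sym; trans; cong; subst; _≗_; module ≡-Reasoning)
open import Relation.Nullary using (¬_; Dec; yes; no; ¬?; contradiction)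
open import Relation.Nullary.Decidable using (map′; from-yes; _×-dec_; _→-dec_)
open import Relation.Unary using (Decidable; _≐_)

open Equivalence using (to; from)

filter-map : ∀ {A B : Set} {P : B → Set} (P? : Decidable P) (f : A → B) xs →
  filter P? (map f xs) ≡ map f (filter (P? ∘ f) xs)
filter-map P? f [] = refl
filter-map {P = P} P? f (x ∷ xs) = by-cases (P? (f x))
  where
  open ≡-Reasoning
  by-cases : Dec (P (f x)) → filter P? (map f (x ∷ xs)) ≡ map f (filter (P? ∘ f) (x ∷ xs))
  by-cases (yes px) = begin
    filter P? (f x ∷ map f xs)        ≡⟨ filter-accept P? px ⟩
    f x ∷ filter P? (map f xs)        ≡⟨ cong (f x ∷_) (filter-map P? f xs) ⟩
    map f (x ∷ filter (P? ∘ f) xs)    ≡⟨ cong (map f) (filter-accept (P? ∘ f) px) ⟨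
    map f (filter (P? ∘ f) (x ∷ xs))  ∎
  by-cases (no ¬px) = begin
    filter P? (f x ∷ map f xs)        ≡⟨ filter-reject P? ¬px ⟩
    filter P? (map f xs)              ≡⟨ filter-map P? f xs ⟩
    map f (filter (P? ∘ f) xs)        ≡⟨ cong (map f) (filter-reject (P? ∘ f) ¬px) ⟨
    map f (filter (P? ∘ f) (x ∷ xs))  ∎

module _ {A B : Set} (_≟ᴮ_ : DecidableEquality B) (f : A → B) where

  deduplicate-map : ∀ xs →
    deduplicate _≟ᴮ_ (map f xs) ≡ map f (deduplicate (λ x y → f x ≟ᴮ f y) xs)
  deduplicate-map [] = refl
  deduplicate-map (x ∷ xs) = cong (f x ∷_) (trans
    (cong (filter (¬? ∘ (f x ≟ᴮ_))) (deduplicate-map xs))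
    (filter-map (¬? ∘ (f x ≟ᴮ_)) f (deduplicate (λ x y → f x ≟ᴮ f y) xs)))

module _ {A : Set} {R S : A → A → Set} (R? : Binary.Decidable R) (S? : Binary.Decidable S) where

  deduplicate-≐ : (∀ x y → R x y ⇔ S x y) → deduplicate R? ≗ deduplicate S?
  deduplicate-≐ R⇔S [] = refl
  deduplicate-≐ R⇔S (x ∷ xs) = cong (x ∷_) (trans
    (cong (filter (¬? ∘ R? x)) (deduplicate-≐ R⇔S xs))
    (filter-≐ (¬? ∘ R? x) (¬? ∘ S? x)
      ((λ ¬r s → ¬r (from (R⇔S x _) s)) , (λ ¬s r → ¬s (to (R⇔S x _) r)))
      (deduplicate S? xs)))

ProperEdge : ∀ {n} → (Fin n → ℕ) → Subset n → Set
ProperEdge f e = 1 < numColors f e × numColors f e < ∣ e ∣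

ProperColoringExcept : ∀ {n} → (Fin n → ℕ) → List (Subset n) → Subset n → Set
ProperColoringExcept f E e = All (λ e′ → e′ ≢ e → ProperEdge f e′) E

SameKernel : ∀ {n} → (Fin n → ℕ) → (Fin n → ℕ) → Set
SameKernel f g = ∀ i j → f i ≡ f j ⇔ g i ≡ g j

module _ {n} {f g : Fin n → ℕ} (f≈g : SameKernel f g) where

  numColors-kernel : ∀ e → numColors f e ≡ numColors g e
  numColors-kernel e = begin
    length (deduplicate _≟_ (map f (elems e)))       ≡⟨ distinct-images f ⟩
    length (deduplicate (same-colour f) (elems e))   ≡⟨ cong length (deduplicate-≐ _ _ f≈g (elems e)) ⟩
    length (deduplicate (same-colour g) (elems e))   ≡⟨ distinct-images g ⟨
    length (deduplicate _≟_ (map g (elems e)))       ∎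
    where
    open ≡-Reasoning
    same-colour : (h : Fin n → ℕ) → Binary.Decidable (λ i j → h i ≡ h j)
    same-colour h i j = h i ≟ h j
    distinct-images : ∀ h → length (deduplicate _≟_ (map h (elems e)))
                          ≡ length (deduplicate (same-colour h) (elems e))
    distinct-images h = trans (cong length (deduplicate-map _≟_ h (elems e)))
                              (length-map h (deduplicate (same-colour h) (elems e)))

  properEdge-kernel : ∀ {e} → ProperEdge f e → ProperEdge g e
  properEdge-kernel {e} (1<k , k<∣e∣) rewrite numColors-kernel e = 1<k , k<∣e∣

  properColoring-kernel : ∀ {E} → ProperColoring f E → ProperColoring g E
  properColoring-kernel = All.map (λ {e} → properEdge-kernel {e})

  properColoringExcept-kernel : ∀ {E e} → ProperColoringExcept f E e → ProperColoringExcept g E e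
  properColoringExcept-kernel = All.map (λ {e′} proper e′≢e → properEdge-kernel {e′} (proper e′≢e))

≗⇒sameKernel : ∀ {n} {f g : Fin n → ℕ} → f ≗ g → SameKernel f g
≗⇒sameKernel f≗g i j rewrite f≗g i | f≗g j = mk⇔ id id

sameKernel-sym : ∀ {n} {f g : Fin n → ℕ} → SameKernel f g → SameKernel g f
sameKernel-sym f≈g i j = mk⇔ (from (f≈g i j)) (to (f≈g i j))

-- Deciding properties of colourings

-- Vertex 0 repeats a colour of the later vertices or gets the fresh colour n;
-- listing the fresh colour last makes searches meet few-coloured colourings first.
extensions : ∀ {n} → Vec ℕ n → List (Vec ℕ (suc n))
extensions {n} c = map (_∷ c) (deduplicate _≟_ (toList c) ++ n ∷ [])

canonical : (n : ℕ) → List (Vec ℕ n)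
canonical zero = [] ∷ []
canonical (suc n) = concatMap extensions (canonical n)

canonical-∷ : ∀ {n h} {c : Vec ℕ n} → c ∈ canonical n → h ∈ deduplicate _≟_ (toList c) ++ n ∷ [] →
              h ∷ c ∈ canonical (suc n)
canonical-∷ {c = c} c∈ h∈ = ∈-concatMap⁺ extensions (Any.map (λ { refl → ∈-map⁺ (_∷ c) h∈ }) c∈)

sameKernel-∷ : ∀ {n} {f : Fin (suc n) → ℕ} {h} {c : Vec ℕ n} →
  SameKernel (f ∘ suc) (lookup c) → (∀ j → f zero ≡ f (suc j) ⇔ h ≡ lookup c j) →
  SameKernel f (lookup (h ∷ c))
sameKernel-∷ _    _    zero    zero    = mk⇔ (λ _ → refl) (λ _ → refl)
sameKernel-∷ _    head zero    (suc j) = head j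
sameKernel-∷ _    head (suc i) zero    = mk⇔ (sym ∘ to (head i) ∘ sym) (sym ∘ from (head i) ∘ sym)
sameKernel-∷ tail _    (suc i) (suc j) = tail i j

canonical-complete : ∀ {n} (f : Fin n → ℕ) →
  ∃ λ c → c ∈ canonical n × SameKernel f (lookup c) × (∀ i → lookup c i < n)
canonical-complete {zero} f = [] , here refl , (λ ()) , (λ ())
canonical-complete {suc n} f with canonical-complete (f ∘ suc) | Fin.any? (λ j → f zero ≟ f (suc j))
... | c , c∈ , tail , c<n | yes (k , f0≡fk) =
  lookup c k ∷ c , canonical-∷ c∈ (∈-++⁺ˡ (∈-deduplicate⁺ _≟_ (∈-toList⁺ (∈-lookup k c)))) ,
  sameKernel-∷ tail head , λ { zero → m<n⇒m<1+n (c<n k) ; (suc i) → m<n⇒m<1+n (c<n i) }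
  where
  head : ∀ j → f zero ≡ f (suc j) ⇔ lookup c k ≡ lookup c j
  head j = mk⇔ (to (tail k j) ∘ trans (sym f0≡fk)) (trans f0≡fk ∘ from (tail k j))
... | c , c∈ , tail , c<n | no f0-fresh =
  n ∷ c , canonical-∷ c∈ (∈-++⁺ʳ (deduplicate _≟_ (toList c)) (here refl)) ,
  sameKernel-∷ tail head , λ { zero → n<1+n n ; (suc i) → m<n⇒m<1+n (c<n i) }
  where
  head : ∀ j → f zero ≡ f (suc j) ⇔ n ≡ lookup c j
  head j = mk⇔ (λ f0≡fj → contradiction (j , f0≡fj) f0-fresh)
               (λ n≡cj → contradiction (sym n≡cj) (<⇒≢ (c<n j)))

KernelInvariant : ∀ {n} → ((Fin n → ℕ) → Set) → Set
KernelInvariant P = ∀ {f g} → SameKernel f g → P f → P g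

module _ {n} {P : (Fin n → ℕ) → Set} (P-kernel : KernelInvariant P) where

  ∃-coloring? : (∀ f → Dec (P f)) → Dec (∃ P)
  ∃-coloring? P? = map′
    (λ some → let c , _ , Pc = find some in lookup c , Pc)
    (λ (f , Pf) → let c , c∈ , f≈c , _ = canonical-complete f in lose c∈ (P-kernel f≈c Pf))
    (any? (P? ∘ lookup) (canonical n))

  ∀-coloring : All (P ∘ lookup) (canonical n) → ∀ f → P f
  ∀-coloring all f = let c , c∈ , f≈c , _ = canonical-complete f in
    P-kernel (sameKernel-sym f≈c) (All.lookup all c∈)

_≟ₛ_ : ∀ {n} → DecidableEquality (Subset n)
_≟ₛ_ = ≡-dec Bool._≟_

properEdge? : ∀ {n} (f : Fin n → ℕ) e → Dec (ProperEdge f e)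
properEdge? f e = (1 <? numColors f e) ×-dec (numColors f e <? ∣ e ∣)

properColoring? : ∀ {n} (f : Fin n → ℕ) E → Dec (ProperColoring f E)
properColoring? f = all? (properEdge? f)

properColoringExcept? : ∀ {n} (f : Fin n → ℕ) E e → Dec (ProperColoringExcept f E e)
properColoringExcept? f E e = all? (λ e′ → ¬? (e′ ≟ₛ e) →-dec properEdge? f e′) E

-- E is the edge list of an r-uniform minimal uncolourable bi-hypergraph.
record Critical {n} (r : ℕ) (E : List (Subset n)) : Set where
  field
    distinct    : Unique E
    uniform     : All (λ e → ∣ e ∣ ≡ r) E
    covering    : ∀ v → Any (v Subset.∈_) E
    uncolorable : ¬ ColorableEdges E
    critical    : All (λ e → ∃ λ f → ProperColoringExcept f E e) E

critical? : ∀ {n} r (E : List (Subset n)) → Dec (Critical r E)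
critical? r E = map′
  (λ (dist , unif , cov , uncol , crit) → record
    { distinct = dist ; uniform = unif ; covering = cov ; uncolorable = uncol ; critical = crit })
  (λ C → let open Critical C in distinct , uniform , covering , uncolorable , critical)
  (unique? E ×-dec all? (λ e → ∣ e ∣ ≟ r) E ×-dec Fin.all? (λ v → any? (v ∈?_) E)
    ×-dec ¬? colorable? ×-dec all? colorableExcept? E)
  where
  open import Data.List.Relation.Unary.Unique.DecPropositional _≟ₛ_ using (unique?)
  colorable? : Dec (ColorableEdges E)
  colorable? = ∃-coloring? (λ f≈g → properColoring-kernel f≈g) (λ f → properColoring? f E)
  colorableExcept? : ∀ e → Dec (∃ λ f → ProperColoringExcept f E e)
  colorableExcept? e = ∃-coloring? (λ f≈g → properColoringExcept-kernel f≈g) (λ f → properColoringExcept? f E e)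

∃-vec? : ∀ {k} n {P : Vec (Fin k) n → Set} → (∀ v → Dec (P v)) → Dec (∃ P)
∃-vec? zero P? = map′ ([] ,_) (λ { ([] , p) → p }) (P? [])
∃-vec? (suc n) P? = map′ (λ (x , v , p) → x ∷ v , p) (λ { (x ∷ v , p) → x , v , p })
  (Fin.any? λ x → ∃-vec? n (λ v → P? (x ∷ v)))

private
  elems-∷ : ∀ {n} b (p : Subset n) → filter (_∈? b ∷ p) (Data.List.tabulate suc) ≡ map suc (elems p)
  elems-∷ b p = begin
    filter (_∈? b ∷ p) (Data.List.tabulate suc)         ≡⟨ cong (filter _) (map-tabulate id suc) ⟨
    filter (_∈? b ∷ p) (map suc (allFin _))             ≡⟨ filter-map (_∈? b ∷ p) suc (allFin _) ⟩
    map suc (filter (λ i → suc i ∈? b ∷ p) (allFin _))  ≡⟨ cong (map suc) (filter-≐ _ _ ∈⇔∈ (allFin _)) ⟩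
    map suc (elems p)                                   ∎
    where
    open ≡-Reasoning
    ∈⇔∈ : (λ i → suc i Subset.∈ b ∷ p) ≐ (Subset._∈ p)
    ∈⇔∈ = drop-there , Vec.there

elems-outside : ∀ {n} (p : Subset n) → elems (outside ∷ p) ≡ map suc (elems p)
elems-outside = elems-∷ outside

elems-inside : ∀ {n} (p : Subset n) → elems (inside ∷ p) ≡ zero ∷ map suc (elems p)
elems-inside p = cong (zero ∷_) (elems-∷ inside p)

elems-⊥ : ∀ n → elems (⊥ {n}) ≡ []
elems-⊥ zero = refl
elems-⊥ (suc n) = trans (elems-outside ⊥) (cong (map suc) (elems-⊥ n))

module _ {n : ℕ} where

  private
    map-suc-↑ˡ : ∀ {k} (xs : List (Fin k)) → map suc (map (_↑ˡ n) xs) ≡ map (_↑ˡ n) (map suc xs)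
    map-suc-↑ˡ xs = trans (sym (map-∘ xs)) (map-∘ xs)

  elems-⧺⊥ : ∀ {k} (p : Subset k) → elems (p ⧺ ⊥ {n}) ≡ map (_↑ˡ n) (elems p)
  elems-⧺⊥ [] = elems-⊥ n
  elems-⧺⊥ (outside ∷ p) = begin
    elems (outside ∷ p ⧺ ⊥)             ≡⟨ elems-outside (p ⧺ ⊥) ⟩
    map suc (elems (p ⧺ ⊥))             ≡⟨ cong (map suc) (elems-⧺⊥ p) ⟩
    map suc (map (_↑ˡ n) (elems p))     ≡⟨ map-suc-↑ˡ (elems p) ⟩
    map (_↑ˡ n) (map suc (elems p))     ≡⟨ cong (map (_↑ˡ n)) (elems-outside p) ⟨
    map (_↑ˡ n) (elems (outside ∷ p))   ∎
    where open ≡-Reasoning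
  elems-⧺⊥ (inside ∷ p) = begin
    elems (inside ∷ p ⧺ ⊥)                    ≡⟨ elems-inside (p ⧺ ⊥) ⟩
    zero ∷ map suc (elems (p ⧺ ⊥))            ≡⟨ cong (λ xs → zero ∷ map suc xs) (elems-⧺⊥ p) ⟩
    zero ∷ map suc (map (_↑ˡ n) (elems p))    ≡⟨ cong (zero ∷_) (map-suc-↑ˡ (elems p)) ⟩
    map (_↑ˡ n) (zero ∷ map suc (elems p))    ≡⟨ cong (map (_↑ˡ n)) (elems-inside p) ⟨
    map (_↑ˡ n) (elems (inside ∷ p))          ∎
    where open ≡-Reasoning

  elems-⊥⧺ : ∀ k (q : Subset n) → elems (⊥ {k} ⧺ q) ≡ map (k ↑ʳ_) (elems q)
  elems-⊥⧺ zero q = sym (map-id (elems q))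
  elems-⊥⧺ (suc k) q = begin
    elems (outside ∷ ⊥ ⧺ q)          ≡⟨ elems-outside (⊥ ⧺ q) ⟩
    map suc (elems (⊥ {k} ⧺ q))      ≡⟨ cong (map suc) (elems-⊥⧺ k q) ⟩
    map suc (map (k ↑ʳ_) (elems q))  ≡⟨ map-∘ (elems q) ⟨
    map (suc k ↑ʳ_) (elems q)        ∎
    where open ≡-Reasoning

  ∣p⧺⊥∣≡∣p∣ : ∀ {k} (p : Subset k) → ∣ p ⧺ ⊥ {n} ∣ ≡ ∣ p ∣
  ∣p⧺⊥∣≡∣p∣ [] = ∣⊥∣≡0 n
  ∣p⧺⊥∣≡∣p∣ (outside ∷ p) = ∣p⧺⊥∣≡∣p∣ p
  ∣p⧺⊥∣≡∣p∣ (inside ∷ p) = cong suc (∣p⧺⊥∣≡∣p∣ p)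

  ∣⊥⧺q∣≡∣q∣ : ∀ k (q : Subset n) → ∣ ⊥ {k} ⧺ q ∣ ≡ ∣ q ∣
  ∣⊥⧺q∣≡∣q∣ zero q = refl
  ∣⊥⧺q∣≡∣q∣ (suc k) q = ∣⊥⧺q∣≡∣q∣ k q

∈-⧺ˡ : ∀ {k n} {i : Fin k} {p : Subset k} (q : Subset n) → i Subset.∈ p → i ↑ˡ n Subset.∈ p ⧺ q
∈-⧺ˡ q Vec.here = Vec.here
∈-⧺ˡ q (Vec.there i∈p) = Vec.there (∈-⧺ˡ q i∈p)

properEdge-≡ : ∀ {n k} {f : Fin n → ℕ} {g : Fin k → ℕ} {e e′} →
  numColors f e ≡ numColors g e′ → ∣ e ∣ ≡ ∣ e′ ∣ → ProperEdge f e ⇔ ProperEdge g e′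
properEdge-≡ p q rewrite p | q = mk⇔ id id

module _ {k n} (f : Fin (k + n) → ℕ) where

  properEdge-⧺⊥ : ∀ p → ProperEdge f (p ⧺ ⊥) ⇔ ProperEdge (f ∘ (_↑ˡ n)) p
  properEdge-⧺⊥ p = properEdge-≡ {f = f} {f ∘ (_↑ˡ n)} {p ⧺ ⊥} {p}
    (cong (length ∘ deduplicate _≟_) (trans (cong (map f) (elems-⧺⊥ p)) (sym (map-∘ (elems p)))))
    (∣p⧺⊥∣≡∣p∣ p)

  properEdge-⊥⧺ : ∀ q → ProperEdge f (⊥ ⧺ q) ⇔ ProperEdge (f ∘ (k ↑ʳ_)) q
  properEdge-⊥⧺ q = properEdge-≡ {f = f} {f ∘ (k ↑ʳ_)} {⊥ ⧺ q} {q}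
    (cong (length ∘ deduplicate _≟_) (trans (cong (map f) (elems-⊥⧺ k q)) (sym (map-∘ (elems q)))))
    (∣⊥⧺q∣≡∣q∣ k q)

upper : ∀ {n} → (Fin n → ℕ) → ℕ
upper {zero} t = 0
upper {suc n} t = suc (t zero) ⊔ upper (t ∘ suc)

below-upper : ∀ {n} (t : Fin n → ℕ) i → t i < upper t
below-upper t zero = m≤m⊔n _ (upper (t ∘ suc))
below-upper t (suc i) = <-≤-trans (below-upper (t ∘ suc) i) (m≤n⊔m _ _)

withFresh : ∀ {n} k → (Fin n → ℕ) → Fin (n + k) → ℕ
withFresh k t = t Vector.++ λ j → upper t + toℕ j

sameKernel-withFresh : ∀ {n} k {t c : Fin n → ℕ} → SameKernel t c → SameKernel (withFresh k t) (withFresh k c)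
sameKernel-withFresh {n} k {t} {c} t≈c i j = kernel (splitAt n i) (splitAt n j)
  where
  fresh : (Fin n → ℕ) → Fin k → ℕ
  fresh t j = upper t + toℕ j
  fresh-injective : ∀ t {i j} → fresh t i ≡ fresh t j → i ≡ j
  fresh-injective t = Fin.toℕ-injective ∘ +-cancelˡ-≡ (upper t) _ _
  fresh-unused : ∀ t i j → t i ≢ fresh t j
  fresh-unused t i j = <⇒≢ (<-≤-trans (below-upper t i) (m≤m+n _ _))
  kernel : ∀ u v → [ t , fresh t ] u ≡ [ t , fresh t ] v ⇔ [ c , fresh c ] u ≡ [ c , fresh c ] v
  kernel (inj₁ i) (inj₁ j) = t≈c i j
  kernel (inj₂ i) (inj₂ j) = mk⇔ (cong (fresh c) ∘ fresh-injective t) (cong (fresh t) ∘ fresh-injective c)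
  kernel (inj₁ i) (inj₂ j) = mk⇔ (⊥-elim ∘ fresh-unused t i j) (⊥-elim ∘ fresh-unused c i j)
  kernel (inj₂ i) (inj₁ j) = mk⇔ (⊥-elim ∘ fresh-unused t j i ∘ sym) (⊥-elim ∘ fresh-unused c j i ∘ sym)

-- The gadget

front : ∀ {m} → Subset (3 + m)
front = ⊤ {3} ⧺ ⊥

-- Vertices 0, 1, 2 are the new vertices x, y, z and 3, 4, 5 the vertices a, b, c
-- of the replaced edge.  The first edge xyz is again front, so the replacement
-- can be iterated.
gadget : List (Subset 6)
gadget = front
       ∷ ⁅ # 0 ⁆ ∪ ⁅ # 3 ⁆ ∪ ⁅ # 4 ⁆ ∷ ⁅ # 1 ⁆ ∪ ⁅ # 3 ⁆ ∪ ⁅ # 4 ⁆ ∷ ⁅ # 2 ⁆ ∪ ⁅ # 3 ⁆ ∪ ⁅ # 4 ⁆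
       ∷ ⁅ # 0 ⁆ ∪ ⁅ # 1 ⁆ ∪ ⁅ # 5 ⁆ ∷ ⁅ # 0 ⁆ ∪ ⁅ # 2 ⁆ ∪ ⁅ # 5 ⁆ ∷ []

gadget-forces : ∀ φ → ProperColoring φ gadget → ProperEdge φ (⊥ {3} ⧺ ⊤ {3})
gadget-forces = ∀-coloring invariant (from-yes (all? (forces? ∘ lookup) (canonical 6)))
  where
  Forces : (Fin 6 → ℕ) → Set
  Forces φ = ProperColoring φ gadget → ProperEdge φ (⊥ {3} ⧺ ⊤ {3})
  forces? : ∀ φ → Dec (Forces φ)
  forces? φ = properColoring? φ gadget →-dec properEdge? φ (⊥ {3} ⧺ ⊤ {3})
  invariant : KernelInvariant Forces
  invariant φ≈ψ forces =
    properEdge-kernel φ≈ψ {⊥ {3} ⧺ ⊤ {3}} ∘ forces ∘ properColoring-kernel (sameKernel-sym φ≈ψ)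

-- σ picks the colours of x, y, z among those of a, b, c and two fresh ones.
slots : Vec (Fin 5) 3 → Fin 6 → Fin 5
slots σ = lookup σ Vector.++ (_↑ˡ 2)

extension : (Fin 3 → ℕ) → Vec (Fin 5) 3 → Fin 6 → ℕ
extension t σ = withFresh 2 t ∘ slots σ

Extendable : (Fin 3 → ℕ) → Set
Extendable t = (ProperEdge t ⊤ → ∃ λ σ → ProperColoring (extension t σ) gadget)
             × (¬ ProperEdge t ⊤ → All (λ r → ∃ λ σ → ProperColoringExcept (extension t σ) gadget r) gadget)

gadget-extendable : ∀ t → Extendable t
gadget-extendable = ∀-coloring invariant (from-yes (all? (extendable? ∘ lookup) (canonical 3)))
  where
  extendable? : ∀ t → Dec (Extendable t)
  extendable? t = (properEdge? t ⊤ →-dec ∃-vec? 3 (λ σ → properColoring? (extension t σ) gadget))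
    ×-dec (¬? (properEdge? t ⊤) →-dec
           all? (λ r → ∃-vec? 3 (λ σ → properColoringExcept? (extension t σ) gadget r)) gadget)
  invariant : KernelInvariant Extendable
  invariant {t} {c} t≈c (extends , extends-except) =
      (λ proper → let σ , pσ = extends (properEdge-kernel (sameKernel-sym t≈c) {⊤} proper)
                  in σ , properColoring-kernel (extension-kernel σ) pσ)
    , (λ improper → All.map (λ (σ , pσ) → σ , properColoringExcept-kernel (extension-kernel σ) pσ)
                      (extends-except (improper ∘ properEdge-kernel t≈c {⊤})))
    where
    extension-kernel : ∀ σ → SameKernel (extension t σ) (extension c σ)
    extension-kernel σ i j = sameKernel-withFresh 2 t≈c (slots σ i) (slots σ j)

-- Replacing the edge front by the gadget

-- The new vertices are 0, 1, 2; the old vertex v becomes 3 ↑ʳ v.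
replaceFront : ∀ {m} → List (Subset (3 + m)) → List (Subset (6 + m))
replaceFront R = map (_⧺ ⊥) gadget ++ map (⊥ {3} ⧺_) R

module _ {m} {R : List (Subset (3 + m))} (C : Critical 3 (front ∷ R)) where

  private
    module C = Critical C
    E′ = replaceFront R

    front∉R : All (front ≢_) R
    front∉R = AllPairs.head C.distinct

    -- every gadget edge contains one of the new vertices
    gadget≢lifted : All (λ p → ∀ e → p ⧺ ⊥ {m} ≢ ⊥ {3} ⧺ e) gadget
    gadget≢lifted = (λ _ ()) ∷ (λ _ ()) ∷ (λ _ ()) ∷ (λ _ ()) ∷ (λ _ ()) ∷ (λ _ ()) ∷ []

    gadget-vertex : (i : Fin 6) → Any (i ↑ˡ m Subset.∈_) E′
    gadget-vertex i = Any.++⁺ˡ (Any.map⁺ {f = _⧺ ⊥ {m}}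
      (Any.map (∈-⧺ˡ ⊥) (from-yes (Fin.all? (λ j → any? (j ∈?_) gadget)) i)))

  replaceFront-distinct : Unique E′
  replaceFront-distinct = Unique.++⁺
    (Unique.map⁺ (++-injectiveˡ {ys = ⊥ {m}} _ _) (from-yes (unique? gadget)))
    (Unique.map⁺ (++-injectiveʳ (⊥ {3}) ⊥) (AllPairs.tail C.distinct))
    λ (v∈gadget , v∈R) → let p , p∈ , v≡p = ∈-map⁻ (_⧺ ⊥) v∈gadget
                             e , _ , v≡e = ∈-map⁻ (⊥ {3} ⧺_) v∈R
                         in All.lookup gadget≢lifted p∈ e (trans (sym v≡p) v≡e)
    where open import Data.List.Relation.Unary.Unique.DecPropositional _≟ₛ_ using (unique?)

  replaceFront-uniform : All (λ e → ∣ e ∣ ≡ 3) E′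
  replaceFront-uniform = All.++⁺
    (All.map⁺ {f = _⧺ ⊥ {m}}
      (All.map (λ {p} ∣p∣≡3 → trans (∣p⧺⊥∣≡∣p∣ p) ∣p∣≡3) (from-yes (all? (λ p → ∣ p ∣ ≟ 3) gadget))))
    (All.map⁺ {f = ⊥ {3} ⧺_} (All.map (λ {e} ∣e∣≡3 → trans (∣⊥⧺q∣≡∣q∣ 3 e) ∣e∣≡3) (All.tail C.uniform)))

  replaceFront-covering : ∀ v → Any (v Subset.∈_) E′
  replaceFront-covering zero = gadget-vertex (# 0)
  replaceFront-covering (suc zero) = gadget-vertex (# 1)
  replaceFront-covering (suc (suc zero)) = gadget-vertex (# 2)
  replaceFront-covering (suc (suc (suc zero))) = gadget-vertex (# 3)
  replaceFront-covering (suc (suc (suc (suc zero)))) = gadget-vertex (# 4)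
  replaceFront-covering (suc (suc (suc (suc (suc zero))))) = gadget-vertex (# 5)
  replaceFront-covering (suc (suc (suc (suc (suc (suc w)))))) with C.covering (3 ↑ʳ w)
  ... | here (Vec.there (Vec.there (Vec.there w∈⊥))) = ⊥-elim (∉⊥ w∈⊥)
  ... | there w∈R = Any.++⁺ʳ _ (Any.map⁺ (Any.map (Vec.there ∘ Vec.there ∘ Vec.there) w∈R))

  replaceFront-uncolorable : ¬ ColorableEdges E′
  replaceFront-uncolorable (g , proper) = C.uncolorable (f , f-front ∷ f-R)
    where
    f = g ∘ (3 ↑ʳ_)
    on-gadget : ProperColoring (g ∘ (_↑ˡ m)) gadget
    on-gadget = All.map (λ {p} → to (properEdge-⧺⊥ g p))
      (All.map⁻ {f = _⧺ ⊥ {m}} (All.++⁻ˡ (map (_⧺ ⊥) gadget) proper))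
    f-front : ProperEdge f front
    f-front = from (properEdge-⧺⊥ f (⊤ {3}))
      (to (properEdge-⊥⧺ {k = 3} (g ∘ (_↑ˡ m)) (⊤ {3})) (gadget-forces _ on-gadget))
    f-R : ProperColoring f R
    f-R = All.map (λ {e} → to (properEdge-⊥⧺ {k = 3} g e))
      (All.map⁻ {f = ⊥ {3} ⧺_} (All.++⁻ʳ (map (_⧺ ⊥) gadget) proper))

  private
    extend-coloring : ∀ (f : Fin (3 + m) → ℕ) σ {r} →
      All (λ p → p ⧺ ⊥ ≢ r → ProperEdge (extension (f ∘ (_↑ˡ m)) σ) p) gadget →
      All (λ e → ⊥ {3} ⧺ e ≢ r → ProperEdge f e) R →
      ∃ λ g → ProperColoringExcept g E′ r
    extend-coloring f σ on-gadget on-R = g , All.++⁺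
      (All.map⁺ {f = _⧺ ⊥ {m}}
        (All.map (λ {p} proper ne → from (properEdge-⧺⊥ g p) (properEdge-kernel agrees {p} (proper ne))) on-gadget))
      (All.map⁺ {f = ⊥ {3} ⧺_} (All.map (λ {e} proper ne → from (properEdge-⊥⧺ {k = 3} g e) (proper ne)) on-R))
      where
      t = f ∘ (_↑ˡ m)
      g : Fin (6 + m) → ℕ
      g = (withFresh 2 t ∘ lookup σ) Vector.++ f
      pointwise : extension t σ ≗ g ∘ (_↑ˡ m)
      pointwise zero = refl
      pointwise (suc zero) = refl
      pointwise (suc (suc zero)) = refl
      pointwise (suc (suc (suc zero))) = refl
      pointwise (suc (suc (suc (suc zero)))) = refl
      pointwise (suc (suc (suc (suc (suc zero))))) = refl
      agrees = ≗⇒sameKernel pointwise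

  replaceFront-critical : All (λ e → ∃ λ g → ProperColoringExcept g E′ e) E′
  replaceFront-critical = All.++⁺ (All.map⁺ {f = _⧺ ⊥ {m}} gadget-edges) (All.map⁺ {f = ⊥ {3} ⧺_} old-edges)
    where
    gadget-edges : All (λ p → ∃ λ g → ProperColoringExcept g E′ (p ⧺ ⊥)) gadget
    gadget-edges with All.head C.critical
    ... | f , proper-except-front =
      All.map (λ (σ , proper) → extend-coloring f σ (All.map (λ proper ne → proper (ne ∘ cong (_⧺ ⊥))) proper)
                                          (All.map (λ proper _ → proper) f-R))
              (proj₂ (gadget-extendable (f ∘ (_↑ˡ m))) f-front-improper)
      where
      f-R : ProperColoring f R
      f-R = All.zipWith (λ (proper , front≢e) → proper (front≢e ∘ sym)) (All.tail proper-except-front , front∉R)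
      f-front-improper : ¬ ProperEdge (f ∘ (_↑ˡ m)) (⊤ {3})
      f-front-improper proper = C.uncolorable (f , from (properEdge-⧺⊥ f (⊤ {3})) proper ∷ f-R)
    old-edges : All (λ e → ∃ λ g → ProperColoringExcept g E′ (⊥ {3} ⧺ e)) R
    old-edges = All.tabulate λ {e₀} e₀∈R →
      let f , proper-except = All.lookup C.critical (there e₀∈R)
          σ , proper = proj₁ (gadget-extendable (f ∘ (_↑ˡ m)))
                             (to (properEdge-⧺⊥ f (⊤ {3})) (All.head proper-except (All.lookup front∉R e₀∈R)))
      in extend-coloring f σ (All.map (λ proper _ → proper) proper)
                  (All.map (λ proper ne → proper (ne ∘ cong (⊥ {3} ⧺_))) (All.tail proper-except))

  replaceFront-isCritical : Critical 3 E′
  replaceFront-isCritical = record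
    { distinct = replaceFront-distinct ; uniform = replaceFront-uniform ; covering = replaceFront-covering
    ; uncolorable = replaceFront-uncolorable ; critical = replaceFront-critical }

p⊆q⇒∣p∣≡∣q∣⇒p≡q : ∀ {n} {p q : Subset n} → p ⊆ q → ∣ p ∣ ≡ ∣ q ∣ → p ≡ q
p⊆q⇒∣p∣≡∣q∣⇒p≡q {p = []} {[]} _ _ = refl
p⊆q⇒∣p∣≡∣q∣⇒p≡q {p = inside ∷ p} {inside ∷ q} p⊆q eq =
  cong (inside ∷_) (p⊆q⇒∣p∣≡∣q∣⇒p≡q (drop-∷-⊆ p⊆q) (suc-injective eq))
p⊆q⇒∣p∣≡∣q∣⇒p≡q {p = outside ∷ p} {outside ∷ q} p⊆q eq =
  cong (outside ∷_) (p⊆q⇒∣p∣≡∣q∣⇒p≡q (drop-∷-⊆ p⊆q) eq)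
p⊆q⇒∣p∣≡∣q∣⇒p≡q {p = inside ∷ p} {outside ∷ q} p⊆q eq with p⊆q Vec.here
... | ()
p⊆q⇒∣p∣≡∣q∣⇒p≡q {p = outside ∷ p} {inside ∷ q} p⊆q eq =
  contradiction eq (<⇒≢ (s≤s (p⊆q⇒∣p∣≤∣q∣ (drop-∷-⊆ p⊆q))))

module _ {n r} {E : List (Subset n)} (C : Critical r E) where

  private module C = Critical C

  hypergraph : BiHypergraph n
  hypergraph = record
    { edges = E ; unique = C.distinct
    ; sperner = λ e∈ e′∈ e⊆e′ →
        p⊆q⇒∣p∣≡∣q∣⇒p≡q e⊆e′ (trans (All.lookup C.uniform e∈) (sym (All.lookup C.uniform e′∈))) }

  hypergraph-minimalUncolorable : MinimalUncolorable hypergraph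
  hypergraph-minimalUncolorable = C.uncolorable , proper-subhypergraph
    where
    colorable-without : ∀ {e E′} → e ∈ E → All (_∈ E) E′ → ¬ e ∈ E′ → ColorableEdges E′
    colorable-without e∈E E′⊆E e∉E′ = let f , proper = All.lookup C.critical e∈E in
      f , All.tabulate λ e′∈E′ → All.lookup proper (All.lookup E′⊆E e′∈E′) (λ { refl → e∉E′ e′∈E′ })
    proper-subhypergraph : ∀ S → ProperSub S → SubColorable S
    proper-subhypergraph S (inj₂ (e , e∈E , e∉S)) = colorable-without e∈E (Subhypergraph.edges'⊆E S) e∉S
    proper-subhypergraph S (inj₁ (v , v∉S)) =
      let e , e∈E , v∈e = find (C.covering v) in
      colorable-without e∈E (Subhypergraph.edges'⊆E S) (λ e∈S → v∉S (All.lookup (Subhypergraph.edges'⊆V S) e∈S v∈e))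

R₆ : List (Subset 6)
R₆ =
    ⁅ # 0 ⁆ ∪ ⁅ # 1 ⁆ ∪ ⁅ # 3 ⁆ ∷ ⁅ # 0 ⁆ ∪ ⁅ # 1 ⁆ ∪ ⁅ # 4 ⁆ ∷ ⁅ # 0 ⁆ ∪ ⁅ # 2 ⁆ ∪ ⁅ # 3 ⁆
  ∷ ⁅ # 0 ⁆ ∪ ⁅ # 2 ⁆ ∪ ⁅ # 5 ⁆ ∷ ⁅ # 0 ⁆ ∪ ⁅ # 4 ⁆ ∪ ⁅ # 5 ⁆ ∷ ⁅ # 1 ⁆ ∪ ⁅ # 2 ⁆ ∪ ⁅ # 4 ⁆
  ∷ ⁅ # 1 ⁆ ∪ ⁅ # 2 ⁆ ∪ ⁅ # 5 ⁆ ∷ ⁅ # 1 ⁆ ∪ ⁅ # 3 ⁆ ∪ ⁅ # 5 ⁆ ∷ ⁅ # 2 ⁆ ∪ ⁅ # 3 ⁆ ∪ ⁅ # 4 ⁆ ∷ []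

R₇ : List (Subset 7)
R₇ =
    ⁅ # 0 ⁆ ∪ ⁅ # 2 ⁆ ∪ ⁅ # 4 ⁆ ∷ ⁅ # 0 ⁆ ∪ ⁅ # 2 ⁆ ∪ ⁅ # 6 ⁆ ∷ ⁅ # 0 ⁆ ∪ ⁅ # 3 ⁆ ∪ ⁅ # 5 ⁆
  ∷ ⁅ # 0 ⁆ ∪ ⁅ # 5 ⁆ ∪ ⁅ # 6 ⁆ ∷ ⁅ # 1 ⁆ ∪ ⁅ # 2 ⁆ ∪ ⁅ # 5 ⁆ ∷ ⁅ # 1 ⁆ ∪ ⁅ # 3 ⁆ ∪ ⁅ # 4 ⁆
  ∷ ⁅ # 1 ⁆ ∪ ⁅ # 3 ⁆ ∪ ⁅ # 6 ⁆ ∷ ⁅ # 1 ⁆ ∪ ⁅ # 4 ⁆ ∪ ⁅ # 5 ⁆ ∷ ⁅ # 1 ⁆ ∪ ⁅ # 4 ⁆ ∪ ⁅ # 6 ⁆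
  ∷ ⁅ # 2 ⁆ ∪ ⁅ # 3 ⁆ ∪ ⁅ # 5 ⁆ ∷ ⁅ # 2 ⁆ ∪ ⁅ # 4 ⁆ ∪ ⁅ # 6 ⁆ ∷ []

R₈ : List (Subset 8)
R₈ =
    ⁅ # 0 ⁆ ∪ ⁅ # 1 ⁆ ∪ ⁅ # 7 ⁆ ∷ ⁅ # 0 ⁆ ∪ ⁅ # 2 ⁆ ∪ ⁅ # 5 ⁆ ∷ ⁅ # 0 ⁆ ∪ ⁅ # 2 ⁆ ∪ ⁅ # 7 ⁆
  ∷ ⁅ # 0 ⁆ ∪ ⁅ # 4 ⁆ ∪ ⁅ # 5 ⁆ ∷ ⁅ # 0 ⁆ ∪ ⁅ # 5 ⁆ ∪ ⁅ # 6 ⁆ ∷ ⁅ # 1 ⁆ ∪ ⁅ # 2 ⁆ ∪ ⁅ # 5 ⁆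
  ∷ ⁅ # 1 ⁆ ∪ ⁅ # 3 ⁆ ∪ ⁅ # 5 ⁆ ∷ ⁅ # 2 ⁆ ∪ ⁅ # 3 ⁆ ∪ ⁅ # 4 ⁆ ∷ ⁅ # 2 ⁆ ∪ ⁅ # 4 ⁆ ∪ ⁅ # 6 ⁆
  ∷ ⁅ # 2 ⁆ ∪ ⁅ # 4 ⁆ ∪ ⁅ # 7 ⁆ ∷ ⁅ # 2 ⁆ ∪ ⁅ # 5 ⁆ ∪ ⁅ # 7 ⁆ ∷ ⁅ # 3 ⁆ ∪ ⁅ # 4 ⁆ ∪ ⁅ # 6 ⁆
  ∷ ⁅ # 4 ⁆ ∪ ⁅ # 5 ⁆ ∪ ⁅ # 7 ⁆ ∷ []

bound-step : ∀ ℓ n → 3 * ℓ + 12 ≤ 7 * n → 3 * (5 + ℓ) + 12 ≤ 7 * (3 + n)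
bound-step ℓ n bound = begin
  3 * (5 + ℓ) + 12     ≡⟨ cong (_+ 12) (*-distribˡ-+ 3 5 ℓ) ⟩
  15 + 3 * ℓ + 12      ≡⟨ +-assoc 15 (3 * ℓ) 12 ⟩
  15 + (3 * ℓ + 12)    ≤⟨ +-mono-≤ (from-yes (15 ≤? 21)) bound ⟩
  21 + 7 * n           ≡⟨ *-distribˡ-+ 7 3 n ⟨
  7 * (3 + n)          ∎
  where open ≤-Reasoning

family : ∀ j → ∃ λ R → Critical 3 (front ∷ R) × 3 * length (front ∷ R) + 12 ≤ 7 * (6 + j)
family 0 = R₆ , from-yes (critical? 3 (front ∷ R₆)) , ≤-refl
family 1 = R₇ , from-yes (critical? 3 (front ∷ R₇)) , n≤1+n 48
family 2 = R₈ , from-yes (critical? 3 (front ∷ R₈)) , m≤m+n 54 2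
family (suc (suc (suc j))) with family j
... | R , C , bound = drop 1 (replaceFront R) , replaceFront-isCritical {m = 3 + j} C ,
  subst (λ k → 3 * (6 + k) + 12 ≤ 7 * (9 + j)) (sym (length-map _ R)) (bound-step (1 + length R) (6 + j) bound)

theorem1p3 : (n : ℕ) → 6 ≤ n →
    (Σ (BiHypergraph n) λ H → Uniform 3 H × MinimalUncolorable H)
    × (Σ (BiHypergraph n) λ H → Uniform 3 H × MinimalUncolorable H
         × 3 * size H ≤ 7 * n ∸ 12)
theorem1p3 n 6≤n with m≤n⇒∃[o]m+o≡n 6≤n
... | j , refl with family j
... | R , C , bound =
  (hypergraph C , Critical.uniform C , hypergraph-minimalUncolorable C) ,
  (hypergraph C , Critical.uniform C , hypergraph-minimalUncolorable C , m+n≤o⇒m≤o∸n _ bound)
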